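{- Let $\mathcal{P}$ be an $\mathrm{ASP^{fs}}$ program and $\mathcal{Q}$ a query finitely recursive on $\mathcal{P}$. Then the program $\mathit{magicRules}_{\mathcal{Q},\mathcal{P}}$ has a unique stable model, and this stable model is finite.
   Context: Terms are variables or functional terms $f(t_1,\dots,t_k)$. A rule $r$: $a_1 \vee \dots \vee a_n \leftarrow b_1,\dots,b_j,\mathrm{not}\,b_{j+1},\dots,\mathrm{not}\,b_m$ ($n\ge1$); $H(r)$, $B^+(r)$, $B^-(r)$ are head, positive body, negative body atoms, $\mathrm{atoms}(r)$ their union. A program is a finite set of rules; an $\mathrm{ASP^{fs}}$ program is a stratified program (no predicate-dependency cycle through negation), disjunction and function symbols allowed. A fact is a variable-free rule with empty body and one head atom; a predicate is EDB if all its defining rules are facts, IDB otherwise. $\mathrm{Ground}(\mathcal{P})$ is the set of ground instances over ground terms built from $\mathcal{P}$'s function symbols. Stable models are subset-minimal models $M$ of the reduct $\mathrm{Ground}(\mathcal{P})^M$ (ground rules with $B^-\cap M\neq\emptyset$ deleted, negative literals dropped). A query is a ground atom $\mathcal{Q}=g(\bar t)$ with function symbols in $\mathcal{P}$; it is finitely recursive on $\mathcal{P}$ if finitely many ground atoms are relevant, the relevant atoms being $\mathcal{Q}$ and all atoms of $\mathrm{atoms}(r_g)$ for $r_g\in\mathrm{Ground}(\mathcal{P})$ with a relevant head atom. $\mathit{magicRules}_{\mathcal{Q},\mathcal{P}}$: with fresh predicates $\mathrm{magic\_}p$ (same arity as $p$), initialize $D=\emptyset$, $\mathit{magicRules}=\{\mathrm{magic\_}g(\bar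 t).\}$, $S=\{g\}$; while $S\neq\emptyset$, move a predicate $p$ from $S$ to $D$ and, for each $r\in\mathcal{P}$, each $p(\bar t)\in H(r)$ and each $q(\bar s)\in\mathrm{atoms}(r)\setminus\{p(\bar t)\}$ with $q$ IDB, add the rule $\mathrm{magic\_}q(\bar s)\leftarrow\mathrm{magic\_}p(\bar t)$ to $\mathit{magicRules}$ and add $q$ to $S$ if $q\notin D$. $\mathit{magicRules}_{\mathcal{Q},\mathcal{P}}$ is the final value of $\mathit{magicRules}$, viewed as a program whose ground instances range over ground terms built from the function symbols of $\mathcal{P}$. -}

module Defs where

open import Data.Nat using (ℕ)
open import Data.List using (List; []; _∷_; _++_; length; map)
open import Data.List.Membership.Propositional using (_∈_; _∉_)
open import Data.List.Relation.Unary.All using (All)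
open import Data.List.Relation.Unary.Any using (Any)
open import Data.Product using (Σ; ∃; ∃-syntax; _×_; _,_)
open import Data.Sum using (_⊎_)
open import Relation.Nullary using (¬_)
open import Relation.Binary.PropositionalEquality using (_≡_; _≢_)
open import Relation.Binary.Construct.Closure.ReflexiveTransitive using (Star)
open import Function.Bundles using (_⇔_)

-- Syntax
-- Variables, predicate symbols and function symbols are named by ℕ.
-- A function symbol is identified by its name together with its arity
-- (constants are 0-ary function symbols).

data Term : Set where
  var : ℕ → Term
  fn  : ℕ → List Term → Term

data Atom (Pr : Set) : Set where
  atom : Pr → List Term → Atom Pr

pred : ∀ {Pr} → Atom Pr → Pr
pred (atom p _) = p

args : ∀ {Pr} → Atom Pr → List Term
args (atom _ ts) = ts

-- a rule  a₁ ∨ … ∨ aₙ ← b₁,…,bⱼ, not bⱼ₊₁,…, not bₘ   with n ≥ 1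
-- (head = hd ∷ hds, so the head is non-empty by construction)
record Rule (Pr : Set) : Set where
  constructor rule
  field
    hd   : Atom Pr
    hds  : List (Atom Pr)
    posB : List (Atom Pr)
    negB : List (Atom Pr)

open Rule public

H : ∀ {Pr} → Rule Pr → List (Atom Pr)
H r = hd r ∷ hds r

B⁺ : ∀ {Pr} → Rule Pr → List (Atom Pr)
B⁺ = posB

B⁻ : ∀ {Pr} → Rule Pr → List (Atom Pr)
B⁻ = negB

atoms : ∀ {Pr} → Rule Pr → List (Atom Pr)
atoms r = H r ++ B⁺ r ++ B⁻ r

Program : Set → Set
Program Pr = List (Rule Pr)

data SubT : Term → Term → Set where
  here  : ∀ {t} → SubT t t
  there : ∀ {t u f ts} → u ∈ ts → SubT t u → SubT t (fn f ts)

VarFreeT : Term → Set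
VarFreeT t = ∀ x → ¬ SubT (var x) t

VarFreeA : ∀ {Pr} → Atom Pr → Set
VarFreeA a = All VarFreeT (args a)

VarFreeR : ∀ {Pr} → Rule Pr → Set
VarFreeR r = All VarFreeA (atoms r)

IsFact : ∀ {Pr} → Rule Pr → Set
IsFact r = VarFreeR r × hds r ≡ [] × posB r ≡ [] × negB r ≡ []

IDB : Program ℕ → ℕ → Set
IDB P p = ∃[ r ] (r ∈ P × Any (λ a → pred a ≡ p) (H r) × ¬ IsFact r)

EDB : Program ℕ → ℕ → Set
EDB P p = ¬ IDB P p

Subst : Set
Subst = ℕ → Term

mutual
  substT : Subst → Term → Term
  substT σ (var x)   = σ x
  substT σ (fn f ts) = fn f (substTs σ ts)

  substTs : Subst → List Term → List Term
  substTs σ []       = []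
  substTs σ (t ∷ ts) = substT σ t ∷ substTs σ ts

substA : ∀ {Pr} → Subst → Atom Pr → Atom Pr
substA σ (atom p ts) = atom p (substTs σ ts)

substR : ∀ {Pr} → Subst → Rule Pr → Rule Pr
substR σ (rule h hs ps ns) =
  rule (substA σ h) (map (substA σ) hs) (map (substA σ) ps) (map (substA σ) ns)

FunSym : ∀ {Pr} → Program Pr → ℕ → ℕ → Set
FunSym P f k =
  ∃[ r ] (r ∈ P × ∃[ a ] (a ∈ atoms r × ∃[ u ] (u ∈ args a ×
    ∃[ ts ] (SubT (fn f ts) u × length ts ≡ k))))

data UTerm (F : ℕ → ℕ → Set) : Term → Set where
  ufn : ∀ {f ts} → F f (length ts) → All (UTerm F) ts → UTerm F (fn f ts)

UAtom : ∀ {Pr} → (ℕ → ℕ → Set) → Atom Pr → Set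
UAtom F a = All (UTerm F) (args a)

URule : ∀ {Pr} → (ℕ → ℕ → Set) → Rule Pr → Set
URule F r = All (UAtom F) (atoms r)

GroundInst : ∀ {Pr} → (ℕ → ℕ → Set) → Program Pr → Rule Pr → Set
GroundInst F Π gr = ∃[ r ] (r ∈ Π × ∃[ σ ] (substR σ r ≡ gr × URule F gr))

Interp : Set → Set₁
Interp Pr = Atom Pr → Set

ModelOfReduct : ∀ {Pr} → (ℕ → ℕ → Set) → Program Pr → Interp Pr → Interp Pr → Set
ModelOfReduct F Π M N =
  ∀ gr → GroundInst F Π gr → All (λ b → ¬ M b) (B⁻ gr) → All N (B⁺ gr) → Any N (H gr)

StableModel : ∀ {Pr} → (ℕ → ℕ → Set) → Program Pr → Interp Pr → Set₁
StableModel {Pr} F Π M =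
  ModelOfReduct F Π M M ×
  (∀ (N : Interp Pr) → ModelOfReduct F Π M N → (∀ a → N a → M a) → ∀ a → M a → N a)

FiniteSet : ∀ {Pr} → Interp Pr → Set
FiniteSet M = ∃[ L ] (∀ a → M a → a ∈ L)

HasUniqueFiniteStableModel : ∀ {Pr} → (ℕ → ℕ → Set) → Program Pr → Set₁
HasUniqueFiniteStableModel {Pr} F Π =
  Σ (Interp Pr) λ M → StableModel F Π M × FiniteSet M ×
    (∀ M' → StableModel F Π M' → ∀ a → M' a ⇔ M a)

Dep : Program ℕ → ℕ → ℕ → Set
Dep P p q = ∃[ r ] (r ∈ P × Any (λ a → pred a ≡ p) (H r) ×
                    Any (λ a → pred a ≡ q) (B⁺ r ++ B⁻ r))

NegDep : Program ℕ → ℕ → ℕ → Set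
NegDep P p q = ∃[ r ] (r ∈ P × Any (λ a → pred a ≡ p) (H r) ×
                       Any (λ a → pred a ≡ q) (B⁻ r))

Stratified : Program ℕ → Set
Stratified P = ∀ p q → NegDep P p q → ¬ Star (Dep P) q p

data Relevant (P : Program ℕ) (Q : Atom ℕ) : Atom ℕ → Set where
  rel-query : Relevant P Q Q
  rel-step  : ∀ {gr a b} → GroundInst (FunSym P) P gr → a ∈ H gr →
              Relevant P Q a → b ∈ atoms gr → Relevant P Q b

FinitelyRecursive : Program ℕ → Atom ℕ → Set
FinitelyRecursive P Q =
  UAtom (FunSym P) Q × ∃[ L ] (∀ a → Relevant P Q a → a ∈ L)

data MPred : Set where
  magic_ : ℕ → MPred

magicRule : ℕ → List Term → ℕ → List Term → Rule MPred
magicRule q s p t = rule (atom (magic q) s) [] (atom (magic p) t ∷ []) []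

magicFact : ℕ → List Term → Rule MPred
magicFact g t = rule (atom (magic g) t) [] [] []

Gen : Program ℕ → ℕ → Rule MPred → Set
Gen P p x = ∃[ r ] (r ∈ P × ∃[ t ] (atom p t ∈ H r × ∃[ q ] ∃[ s ]
  (atom q s ∈ atoms r × atom q s ≢ atom p t × IDB P q × x ≡ magicRule q s p t)))

Adds : Program ℕ → ℕ → ℕ → Set
Adds P p q = ∃[ r ] (r ∈ P × ∃[ t ] (atom p t ∈ H r × ∃[ s ]
  (atom q s ∈ atoms r × atom q s ≢ atom p t × IDB P q)))

record State : Set where
  constructor ⟨_,_,_⟩
  field
    D  : List ℕ
    S  : List ℕ
    MR : List (Rule MPred)

-- one iteration of the while loop (sets represented by lists, up to
-- membership): move p from S to D, add the generated rules, and add each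
-- encountered IDB q to S if q ∉ D
data Step (P : Program ℕ) : State → State → Set where
  move : ∀ {D S MR p S' New} → p ∈ S →
         (∀ q → q ∈ S' ⇔ ((q ∈ S × q ≢ p) ⊎ (Adds P p q × q ∉ p ∷ D))) →
         (∀ x → x ∈ New ⇔ Gen P p x) →
         Step P ⟨ D , S , MR ⟩ ⟨ p ∷ D , S' , MR ++ New ⟩

MagicRules : Program ℕ → Atom ℕ → List (Rule MPred) → Set
MagicRules P (atom g t) MR =
  ∃[ D ] Star (Step P) ⟨ [] , g ∷ [] , magicFact g t ∷ [] ⟩ ⟨ D , [] , MR ⟩

-- Every rule of magicRules is a fact or a single-headed rule  magic_q(s) ← magic_p(t)
-- without negation, so the program is Horn: its least model, the set of derivable
-- atoms, is a model of every reduct and lies inside every model of every reduct, hence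
-- it is the unique stable model.  It is finite because unmagicking a derivable atom
-- gives an atom relevant to the query: the rule of P that produced magic_q(s) ← magic_p(t)
-- contains p(t) in its head and q(s), and it can be grounded by keeping the substitution
-- on s and t and sending every other variable to a constant.  A constant exists as soon
-- as the atom has an argument; atoms without arguments are finitely many anyway, one per
-- predicate occurring in a head of magicRules.
module Submission where

open import Defs
open import Data.Nat using (ℕ; suc; _≟_)
open import Data.List using (List; []; _∷_; _++_; length; map)
open import Data.List.Properties using (map-++)
open import Data.List.Membership.Propositional using (_∈_)
open import Data.List.Membership.Propositional.Properties using (∈-map⁺; ∈-++⁺ˡ; ∈-++⁺ʳ)
open import Data.List.Relation.Unary.All as All using (All; []; _∷_)
open import Data.List.Relation.Unary.All.Properties using (map⁺; ++⁺)
open import Data.List.Relation.Unary.Any using (here; there)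
open import Data.Product using (∃-syntax; _×_; _,_)
open import Data.Sum using (_⊎_; inj₁; inj₂)
open import Data.Empty using (⊥-elim)
open import Relation.Nullary using (Dec; yes; no)
open import Relation.Nullary.Decidable using (_⊎-dec_)
open import Relation.Unary using (Decidable)
open import Relation.Binary.PropositionalEquality using (_≡_; refl; sym; trans; cong; cong₂; subst)
open import Relation.Binary.Construct.Closure.ReflexiveTransitive using (Star; ε; _◅_)
open import Function.Bundles using (_⇔_; mk⇔; Equivalence)

length-substTs : ∀ σ ts → length (substTs σ ts) ≡ length ts
length-substTs σ []       = refl
length-substTs σ (t ∷ ts) = cong suc (length-substTs σ ts)

OccursIn : ℕ → List Term → Set
OccursIn x ts = ∃[ u ] (u ∈ ts × SubT (var x) u)

mutual
  occurs? : ∀ x u → Dec (SubT (var x) u)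
  occurs? x (var y) with x ≟ y
  ... | yes refl = yes here
  ... | no x≢y   = no λ { here → x≢y refl }
  occurs? x (fn f ts) with occursIn? x ts
  ... | yes (u , u∈ , o) = yes (there u∈ o)
  ... | no ¬o            = no λ { (there u∈ o) → ¬o (_ , u∈ , o) }

  occursIn? : ∀ x ts → Dec (OccursIn x ts)
  occursIn? x [] = no λ { (_ , () , _) }
  occursIn? x (t ∷ ts) with occurs? x t | occursIn? x ts
  ... | yes o  | _                 = yes (t , here refl , o)
  ... | no _   | yes (u , u∈ , o)  = yes (u , there u∈ , o)
  ... | no ¬o  | no ¬os            =
    no λ { (_ , here refl , o) → ¬o o ; (u , there u∈ , o) → ¬os (u , u∈ , o) }

mutual
  substT-cong : ∀ σ σ′ u → (∀ x → SubT (var x) u → σ x ≡ σ′ x) → substT σ u ≡ substT σ′ u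
  substT-cong σ σ′ (var x)   eq = eq x here
  substT-cong σ σ′ (fn f ts) eq =
    cong (fn f) (substTs-cong σ σ′ ts λ { x (_ , u∈ , o) → eq x (there u∈ o) })

  substTs-cong : ∀ σ σ′ ts → (∀ x → OccursIn x ts → σ x ≡ σ′ x) → substTs σ ts ≡ substTs σ′ ts
  substTs-cong σ σ′ []       eq = refl
  substTs-cong σ σ′ (t ∷ ts) eq =
    cong₂ _∷_ (substT-cong σ σ′ t λ x o → eq x (t , here refl , o))
              (substTs-cong σ σ′ ts λ { x (u , u∈ , o) → eq x (u , there u∈ , o) })

SymbolsIn : (ℕ → ℕ → Set) → Term → Set
SymbolsIn F u = ∀ f ts → SubT (fn f ts) u → F f (length ts)

module _ {F : ℕ → ℕ → Set} where

  mutual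
    substT-ground : ∀ σ {u} → UTerm F u → substT σ u ≡ u
    substT-ground σ (ufn {f} _ us) = cong (fn f) (substTs-ground σ us)

    substTs-ground : ∀ σ {ts} → All (UTerm F) ts → substTs σ ts ≡ ts
    substTs-ground σ []       = refl
    substTs-ground σ (u ∷ us) = cong₂ _∷_ (substT-ground σ u) (substTs-ground σ us)

  ground-∈-substTs : ∀ σ {u ts} → u ∈ ts → All (UTerm F) (substTs σ ts) → UTerm F (substT σ u)
  ground-∈-substTs σ (here refl) (g ∷ _)  = g
  ground-∈-substTs σ (there u∈)  (_ ∷ gs) = ground-∈-substTs σ u∈ gs

  ground-var : ∀ σ {x u} → SubT (var x) u → UTerm F (substT σ u) → UTerm F (σ x)
  ground-var σ here          g            = g
  ground-var σ (there u∈ o) (ufn _ gs)    = ground-var σ o (ground-∈-substTs σ u∈ gs)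

  ground-occursIn : ∀ σ {x ts} → OccursIn x ts → All (UTerm F) (substTs σ ts) → UTerm F (σ x)
  ground-occursIn σ (_ , u∈ , o) gs = ground-var σ o (ground-∈-substTs σ u∈ gs)

  mutual
    substT-UTerm : ∀ σ → (∀ x → UTerm F (σ x)) → ∀ u → SymbolsIn F u → UTerm F (substT σ u)
    substT-UTerm σ σ-ground (var x)   _  = σ-ground x
    substT-UTerm σ σ-ground (fn f ts) fs =
      ufn (subst (F f) (sym (length-substTs σ ts)) (fs f ts here))
          (substTs-UTerm σ σ-ground ts
            (All.tabulate λ u∈ f′ ts′ o → fs f′ ts′ (there u∈ o)))

    substTs-UTerm : ∀ σ → (∀ x → UTerm F (σ x)) → ∀ ts → All (SymbolsIn F) ts →
                    All (UTerm F) (substTs σ ts)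
    substTs-UTerm σ σ-ground []       []         = []
    substTs-UTerm σ σ-ground (t ∷ ts) (ft ∷ fts) =
      substT-UTerm σ σ-ground t ft ∷ substTs-UTerm σ σ-ground ts fts

  UTerm-constant : ∀ {u} → UTerm F u → ∃[ c ] F c 0
  UTerm-constant (ufn {f} {[]}    f∈ _)       = f , f∈
  UTerm-constant (ufn {_} {_ ∷ _} _  (g ∷ _)) = UTerm-constant g

  module _ {c : ℕ} (c∈ : F c 0) (σ : Subst) {V : ℕ → Set} (V? : Decidable V) where

    groundOutside : Subst
    groundOutside x with V? x
    ... | yes _ = σ x
    ... | no _  = fn c []

    groundOutside-agrees : ∀ x → V x → σ x ≡ groundOutside x
    groundOutside-agrees x v with V? x
    ... | yes _ = refl
    ... | no ¬v = ⊥-elim (¬v v)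

    groundOutside-ground : (∀ x → V x → UTerm F (σ x)) → ∀ x → UTerm F (groundOutside x)
    groundOutside-ground σ-ground x with V? x
    ... | yes v = σ-ground x v
    ... | no _  = ufn c∈ []

atoms-substR : ∀ {Pr} σ (r : Rule Pr) → atoms (substR σ r) ≡ map (substA σ) (atoms r)
atoms-substR σ r = sym (trans (map-++ (substA σ) (H r) _)
  (cong (map (substA σ) (H r) ++_) (map-++ (substA σ) (posB r) (negB r))))

substA-∈-atoms : ∀ {Pr} σ (r : Rule Pr) {a} → a ∈ atoms r → substA σ a ∈ atoms (substR σ r)
substA-∈-atoms σ r {a} a∈ = subst (substA σ a ∈_) (sym (atoms-substR σ r)) (∈-map⁺ (substA σ) a∈)

substR-groundInst : ∀ {Pr} {P : Program Pr} {r} σ → r ∈ P → (∀ x → UTerm (FunSym P) (σ x)) →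
                    GroundInst (FunSym P) P (substR σ r)
substR-groundInst {P = P} {r = r} σ r∈ σ-ground =
  r , r∈ , σ , refl ,
  subst (All (UAtom (FunSym P))) (sym (atoms-substR σ r)) (map⁺ (All.tabulate ground-atom))
  where
    ground-atom : ∀ {a} → a ∈ atoms r → UAtom (FunSym P) (substA σ a)
    ground-atom {atom p ts} a∈ = substTs-UTerm σ σ-ground ts
      (All.tabulate λ {u} u∈ f ts′ o → r , r∈ , atom p ts , a∈ , u , u∈ , ts′ , o , refl)

pred-substA : ∀ {Pr} σ (a : Atom Pr) → pred (substA σ a) ≡ pred a
pred-substA σ (atom p ts) = refl

Horn : ∀ {Pr} → Rule Pr → Set
Horn r = hds r ≡ [] × negB r ≡ []

data Derivable {Pr : Set} (F : ℕ → ℕ → Set) (Π : Program Pr) : Atom Pr → Set where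
  derive : ∀ {gr} → GroundInst F Π gr → All (Derivable F Π) (B⁺ gr) → Derivable F Π (hd gr)

module _ {Pr : Set} {F : ℕ → ℕ → Set} {Π : Program Pr} where

  Derivable-model : ∀ M → ModelOfReduct F Π M (Derivable F Π)
  Derivable-model M gr gr∈ _ derivable = here (derive gr∈ derivable)

  Derivable-head : ∀ {a} → Derivable F Π a → (∃[ r ] (r ∈ Π × pred (hd r) ≡ pred a)) × UAtom F a
  Derivable-head (derive (r , r∈ , σ , refl , ground-hd ∷ _) _) =
    (r , r∈ , sym (pred-substA σ (hd r))) , ground-hd

  module _ (horn : All Horn Π) {M N : Interp Pr} (N-model : ModelOfReduct F Π M N) where

    mutual
      Derivable-least : ∀ {a} → Derivable F Π a → N a
      Derivable-least (derive (rule _ _ _ _ , r∈ , σ , refl , ground) derivable)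
        with All.lookup horn r∈
      ... | refl , refl with N-model _ (_ , r∈ , σ , refl , ground) [] (Derivable-least* derivable)
      ...   | here n = n

      Derivable-least* : ∀ {as} → All (Derivable F Π) as → All N as
      Derivable-least* []       = []
      Derivable-least* (d ∷ ds) = Derivable-least d ∷ Derivable-least* ds

  horn-stable : All Horn Π → StableModel F Π (Derivable F Π)
  horn-stable horn = Derivable-model _ , λ N N-model _ _ → Derivable-least horn N-model

  horn-stable-unique : All Horn Π → ∀ {M} → StableModel F Π M → ∀ a → M a ⇔ Derivable F Π a
  horn-stable-unique horn (M-model , M-minimal) a =
    mk⇔ (M-minimal _ (Derivable-model _) (λ _ → Derivable-least horn M-model) a)
        (Derivable-least horn M-model)

IsMagicRule : Program ℕ → ℕ → List Term → Rule MPred → Set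
IsMagicRule P g t x = x ≡ magicFact g t ⊎ ∃[ p ] Gen P p x

magicRules-step : ∀ {P g t s s′} → Step P s s′ →
                  All (IsMagicRule P g t) (State.MR s) → All (IsMagicRule P g t) (State.MR s′)
magicRules-step (move _ _ new) shaped =
  ++⁺ shaped (All.tabulate λ x∈ → inj₂ (_ , Equivalence.to (new _) x∈))

magicRules-run : ∀ {P g t s s′} → Star (Step P) s s′ →
                 All (IsMagicRule P g t) (State.MR s) → All (IsMagicRule P g t) (State.MR s′)
magicRules-run ε            shaped = shaped
magicRules-run (step ◅ run) shaped = magicRules-run run (magicRules-step step shaped)

isMagicRule-horn : ∀ {P g t x} → IsMagicRule P g t x → Horn x
isMagicRule-horn (inj₁ refl)                                            = refl , refl
isMagicRule-horn (inj₂ (_ , _ , _ , _ , _ , _ , _ , _ , _ , _ , refl)) = refl , refl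

unmagic : Atom MPred → Atom ℕ
unmagic (atom (magic q) s) = atom q s

magicAtom : Atom ℕ → Atom MPred
magicAtom (atom q s) = atom (magic q) s

magicRule-relevant :
  ∀ {P Q c} → FunSym P c 0 → ∀ {r p t q s} σ → r ∈ P → atom p t ∈ H r → atom q s ∈ atoms r →
  All (UTerm (FunSym P)) (substTs σ s) → All (UTerm (FunSym P)) (substTs σ t) →
  Relevant P Q (atom p (substTs σ t)) → Relevant P Q (atom q (substTs σ s))
magicRule-relevant {P} {Q} c∈ {r} {p} {t} {q} {s} σ r∈ pt∈ qs∈ s-ground t-ground p-relevant =
  subst (λ ts → Relevant P Q (atom q ts)) (sym (agree-on s inj₁))
    (rel-step (substR-groundInst σ′ r∈ σ′-ground) (∈-map⁺ (substA σ′) pt∈)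
      (subst (λ ts → Relevant P Q (atom p ts)) (agree-on t inj₂) p-relevant)
      (substA-∈-atoms σ′ r qs∈))
  where
    V : ℕ → Set
    V x = OccursIn x s ⊎ OccursIn x t

    V? : Decidable V
    V? x = occursIn? x s ⊎-dec occursIn? x t

    σ′ : Subst
    σ′ = groundOutside {F = FunSym P} c∈ σ V?

    σ′-ground : ∀ x → UTerm (FunSym P) (σ′ x)
    σ′-ground = groundOutside-ground {F = FunSym P} c∈ σ V? λ
      { x (inj₁ o) → ground-occursIn σ o s-ground
      ; x (inj₂ o) → ground-occursIn σ o t-ground }

    agree-on : ∀ ts → (∀ {x} → OccursIn x ts → V x) → substTs σ ts ≡ substTs σ′ ts
    agree-on ts inV = substTs-cong σ σ′ ts λ x o →
      groundOutside-agrees {F = FunSym P} c∈ σ V? x (inV o)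

Derivable-relevant :
  ∀ {P g t c MR} → FunSym P c 0 → UAtom (FunSym P) (atom g t) → All (IsMagicRule P g t) MR →
  ∀ {a} → Derivable (FunSym P) MR a → Relevant P (atom g t) (unmagic a)
Derivable-relevant {P} {g} {t} c∈ Q-ground shaped (derive (r , r∈ , σ , refl , ground) derivable)
  with All.lookup shaped r∈
... | inj₁ refl =
  subst (λ ts → Relevant P (atom g t) (atom g ts)) (sym (substTs-ground σ Q-ground)) rel-query
... | inj₂ (_ , _ , r′∈ , _ , pt∈ , _ , _ , qs∈ , _ , _ , refl)
  with ground | derivable
...   | s-ground ∷ t-ground ∷ [] | d ∷ [] =
  magicRule-relevant c∈ σ r′∈ pt∈ qs∈ s-ground t-ground
    (Derivable-relevant c∈ Q-ground shaped d)

Derivable-finite :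
  ∀ {P g t MR} → UAtom (FunSym P) (atom g t) → All (IsMagicRule P g t) MR →
  ∀ {L} → (∀ a → Relevant P (atom g t) a → a ∈ L) → FiniteSet (Derivable (FunSym P) MR)
Derivable-finite {P} {g} {t} {MR} Q-ground shaped {L} relevant⊆L =
  map magicAtom L ++ map nullaryHead MR , listed
  where
    nullaryHead : Rule MPred → Atom MPred
    nullaryHead r = atom (pred (hd r)) []

    listed : ∀ a → Derivable (FunSym P) MR a → a ∈ map magicAtom L ++ map nullaryHead MR
    listed a d with Derivable-head d
    listed (atom _ []) d | (r , r∈ , refl) , _ =
      ∈-++⁺ʳ (map magicAtom L) (∈-map⁺ nullaryHead r∈)
    listed (atom (magic _) (_ ∷ _)) d | _ , u-ground ∷ _ with UTerm-constant u-ground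
    ... | _ , c∈ = ∈-++⁺ˡ (∈-map⁺ magicAtom
      (relevant⊆L _ (Derivable-relevant c∈ Q-ground shaped d)))

lemma4 : (P : Program ℕ) (Q : Atom ℕ) → Stratified P → FinitelyRecursive P Q →
    (MR : List (Rule MPred)) → MagicRules P Q MR →
    HasUniqueFiniteStableModel (FunSym P) MR
lemma4 P (atom g t) _ (Q-ground , _ , relevant⊆L) MR (_ , run) =
  Derivable (FunSym P) MR ,
  horn-stable horn ,
  Derivable-finite Q-ground shaped relevant⊆L ,
  λ _ → horn-stable-unique horn
  where
    shaped : All (IsMagicRule P g t) MR
    shaped = magicRules-run run (inj₁ refl ∷ [])

    horn : All Horn MR
    horn = All.map isMagicRule-horn shaped
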